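{- Let $H$ be a hypergraph with an Euler family $\mathcal F$ and incidence graph $G$, and let $G_{\mathcal F}$ be the subgraph of $G$ corresponding to $\mathcal F$. Let $C$ be an $\mathcal F$-interchanging cycle in $G$, and let $G_1,\ldots,G_k$ be all of the connected components of $G_{\mathcal F}$ that contain vertices of $C$. Assume that for each $i=1,\ldots,k$, the graph $G_i\setminus E(C)$ (obtained from $G_i$ by deleting the edges of $C$) has at most one non-trivial connected component. Then the subgraph of $G_{\mathcal F}\Delta C$ induced by $V(G_1)\cup\cdots\cup V(G_k)$ has at most one non-trivial connected component.
   Context: A hypergraph $H=(V,E)$ has a finite non-empty vertex set $V$ and a finite multiset $E$ of subsets of $V$ (edges; distinct members of the multiset are distinct edges). A walk is a sequence $v_0e_1v_1\dots e_mv_m$ with $v_i\in V$, $e_i\in E$, $v_{i-1},v_i\in e_i$, $v_{i-1}\neq v_i$; the $v_i$ are its anchors; it is a trail if the $e_i$ are pairwise distinct, and closed if $v_0=v_m$ and $m\ge2$. An Euler family of $H$ is a set of pairwise anchor-disjoint and edge-disjoint closed trails that together traverse every edge of $H$. The incidence graph $G$ of $H$ is the simple bipartite graph with vertex set $V\cup E$ (elements of $V$ are v-vertices, elements of $E$ are e-vertices), where $v\in V$ and $e\in E$ are adjacent iff $v\in e$. For an Euler family $\mathcal F$, $G_{\mathcal F}$ is the spanning subgraph of $G$ whose edges are the pairs $ve$ such that $v$ and $e$ occur consecutively (as $\dots ve\dots$ or $\dots ev\dots$) in some closed trail of $\mathcal F$. For simple graphs, $G_1\Delta G_2=(V(G_1)\cup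 V(G_2),E(G_1)\Delta E(G_2))$. A cycle $C$ of $G$ is $\mathcal F$-interchanging if every e-vertex of $C$ is incident with exactly one edge of $C$ that lies in $G_{\mathcal F}$. A connected component is non-trivial if it has more than one vertex. -}

module Defs where

open import Data.Nat using (ℕ; zero; suc; _≤_; _<_)
open import Data.Fin using (Fin; zero; suc; inject₁; fromℕ)
open import Data.Fin.Subset using (Subset; _∈_)
open import Data.Sum using (_⊎_; inj₁; inj₂)
open import Data.Product using (Σ; ∃; _×_; _,_)
open import Data.Empty using (⊥)
open import Relation.Nullary using (¬_)
open import Relation.Binary.PropositionalEquality using (_≡_; _≢_)

-- Hypergraphs: vertex set Fin n (non-empty: 0 < n, imposed in the
-- statement), edges a family indexed by Fin m (so a multiset: distinct
-- indices are distinct edges), each edge a subset of the vertices.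

record Hypergraph : Set where
  field
    n : ℕ
    m : ℕ
    edge : Fin m → Subset n
open Hypergraph public

-- A closed trail  v₀ e₁ v₁ … e_len v_len  with v₀ = v_len, len ≥ 2.
-- Anchor v_i is  anc i  (i : Fin (suc len)); edge e_{i+1} is  edg i.
record ClosedTrail (H : Hypergraph) : Set where
  field
    len   : ℕ
    anc   : Fin (suc len) → Fin (n H)
    edg   : Fin len → Fin (m H)
    len≥2 : 2 ≤ len
    inL   : ∀ i → anc (inject₁ i) ∈ edge H (edg i)
    inR   : ∀ i → anc (suc i) ∈ edge H (edg i)
    step≢ : ∀ i → anc (inject₁ i) ≢ anc (suc i)
    trail : ∀ i j → edg i ≡ edg j → i ≡ j
    closed : anc zero ≡ anc (fromℕ len)
open ClosedTrail public

IsAnchor : ∀ {H} → ClosedTrail H → Fin (n H) → Set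
IsAnchor T v = ∃ λ i → anc T i ≡ v

UsesEdge : ∀ {H} → ClosedTrail H → Fin (m H) → Set
UsesEdge T f = ∃ λ i → edg T i ≡ f

record EulerFamily (H : Hypergraph) : Set where
  field
    t      : ℕ
    trails : Fin t → ClosedTrail H
    anchorDisjoint : ∀ i j v → IsAnchor (trails i) v → IsAnchor (trails j) v → i ≡ j
    edgeDisjoint   : ∀ i j f → UsesEdge (trails i) f → UsesEdge (trails j) f → i ≡ j
    covers         : ∀ f → ∃ λ i → UsesEdge (trails i) f
open EulerFamily public

-- Simple graphs given by a vertex predicate and an edge relation
-- (edge relations used below are symmetric and irreflexive).

record Graph (X : Set) : Set₁ where
  field
    vtx  : X → Set
    adj  : X → X → Set
open Graph public

data Conn {X : Set} (g : Graph X) : X → X → Set where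
  here : ∀ {x} → vtx g x → Conn g x x
  step : ∀ {x y z} → vtx g x → adj g x y → Conn g y z → Conn g x z

NontrivialComp : ∀ {X} → Graph X → X → Set
NontrivialComp g x = vtx g x × ∃ λ z → z ≢ x × Conn g x z

AtMostOneNontrivial : ∀ {X} → Graph X → Set
AtMostOneNontrivial g = ∀ x y → NontrivialComp g x → NontrivialComp g y → Conn g x y

-- Incidence graph.  Vertices: inj₁ v (v-vertices), inj₂ e (e-vertices).

IVert : Hypergraph → Set
IVert H = Fin (n H) ⊎ Fin (m H)

Bip : ∀ {H} → (Fin (n H) → Fin (m H) → Set) → IVert H → IVert H → Set
Bip R (inj₁ v) (inj₂ e) = R v e
Bip R (inj₂ e) (inj₁ v) = R v e
Bip R _ _ = ⊥

IncAdj : (H : Hypergraph) → IVert H → IVert H → Set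
IncAdj H = Bip {H} (λ v e → v ∈ edge H e)

IncGraph : (H : Hypergraph) → Graph (IVert H)
IncGraph H = record { vtx = λ _ → Fin (n H) ⊎ Fin (m H) ; adj = IncAdj H }

ConsecIn : ∀ {H} → EulerFamily H → Fin (n H) → Fin (m H) → Set
ConsecIn F v e = ∃ λ i → ∃ λ p →
  edg (trails F i) p ≡ e × (anc (trails F i) (inject₁ p) ≡ v ⊎ anc (trails F i) (suc p) ≡ v)

GFAdj : ∀ {H} → EulerFamily H → IVert H → IVert H → Set
GFAdj {H} F = Bip {H} (ConsecIn F)

GF : ∀ {H} → EulerFamily H → Graph (IVert H)
GF {H} F = record { vtx = λ _ → IVert H ; adj = GFAdj F }

record Cycle {X : Set} (g : Graph X) : Set where
  field
    clen   : ℕ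
    w      : Fin (suc clen) → X
    clen≥3 : 3 ≤ clen
    cclosed : w zero ≡ w (fromℕ clen)
    distinct : ∀ i j → w (inject₁ i) ≡ w (inject₁ j) → i ≡ j
    inG    : ∀ i → vtx g (w (inject₁ i))
    cadj   : ∀ i → adj g (w (inject₁ i)) (w (suc i))
open Cycle public

OnCycle : ∀ {X} {g : Graph X} → Cycle g → X → Set
OnCycle C x = ∃ λ i → w C i ≡ x

CEdge : ∀ {X} {g : Graph X} → Cycle g → X → X → Set
CEdge C x y = ∃ λ i →
  (w C (inject₁ i) ≡ x × w C (suc i) ≡ y) ⊎ (w C (inject₁ i) ≡ y × w C (suc i) ≡ x)

Interchanging : ∀ {H} → (F : EulerFamily H) → Cycle (IncGraph H) → Set
Interchanging {H} F C = ∀ (e : Fin (m H)) → OnCycle C (inj₂ e) →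
  ∃ λ y → (CEdge C (inj₂ e) y × GFAdj F (inj₂ e) y) ×
    (∀ z → CEdge C (inj₂ e) z → GFAdj F (inj₂ e) z → z ≡ y)

Xor : Set → Set → Set
Xor A B = (A × ¬ B) ⊎ (¬ A × B)

InCompOf : ∀ {H} → EulerFamily H → IVert H → IVert H → Set
InCompOf F c x = Conn (GF F) c x

-- G_i \ E(C), where G_i is the component of G_F containing c
CompMinusC : ∀ {H} (F : EulerFamily H) → Cycle (IncGraph H) → IVert H → Graph (IVert H)
CompMinusC F C c = record
  { vtx = InCompOf F c
  ; adj = λ x y → InCompOf F c x × InCompOf F c y × GFAdj F x y × ¬ CEdge C x y }

-- V(G₁) ∪ … ∪ V(G_k): vertices in a component of G_F containing a vertex of C
InUnion : ∀ {H} → EulerFamily H → Cycle (IncGraph H) → IVert H → Set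
InUnion F C x = ∃ λ c → OnCycle C c × InCompOf F c x

SymDiffInduced : ∀ {H} (F : EulerFamily H) → Cycle (IncGraph H) → Graph (IVert H)
SymDiffInduced F C = record
  { vtx = InUnion F C
  ; adj = λ x y → InUnion F C x × InUnion F C y × Xor (GFAdj F x y) (CEdge C x y) }

module Submission where

-- Every vertex x in a non-trivial component of G_F Δ C is joined in G_F Δ C to an
-- e-vertex of C: either x starts with an edge of C ∖ G_F, or x is non-trivial in
-- some G_i ∖ E(C), whose unique non-trivial component then contains an e-vertex of
-- C, or the v-vertex of C spanning G_i, whose C-edges outside G_F survive in G_F Δ C.
-- Here an e-vertex e of C is always non-trivial in its G_i ∖ E(C): its trail gives it
-- two distinct neighbours in G_F, and only one C-edge at e lies in G_F.
-- It remains to join consecutive e-vertices e, e′ of C across the v-vertex v between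
-- them. A C-edge at v outside G_F survives in G_F Δ C. If ve, ve′ ∈ G_F, both e and e′
-- are non-trivial in G_v ∖ E(C). If only ve ∈ G_F, the trail through v leaves it by a
-- second edge, which is not on C, so v itself is non-trivial in G_v ∖ E(C).

open import Data.Empty using (⊥-elim)
open import Data.Fin using (Fin; zero; suc; inject₁; fromℕ; toℕ)
open import Data.Fin.Induction using (<-weakInduction; <-weakInduction-startingFrom)
open import Data.Fin.Properties using (any?; 0≢1+n; suc-injective; toℕ-inject₁; ≤fromℕ)
  renaming (_≟_ to _≟ᶠ_)
open import Data.Fin.Relation.Unary.Top
  using (View; view; ‵fromℕ; ‵inject₁; view-fromℕ; view-inject₁)
open import Data.Fin.Subset using (_∈_)
open import Data.Nat using (zero; suc; _≤_; _<_; z≤n; s≤s)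
open import Data.Nat.Properties using (1+n≢n; ≤-trans)
open import Data.Product using (∃; _×_; _,_; proj₁; proj₂)
open import Data.Sum using (_⊎_; inj₁; inj₂; [_,_]′; swap)
  renaming (map to map⊎)
open import Data.Sum.Properties using (≡-dec; inj₁-injective; inj₂-injective)
open import Function using (_∘_)
open import Relation.Binary.Definitions using (DecidableEquality)
open import Relation.Nullary using (¬_; Dec; yes; no)
open import Relation.Nullary.Decidable using (_×-dec_; _⊎-dec_)
open import Relation.Binary.PropositionalEquality

open import Defs

csuc : ∀ {N} → Fin N → Fin N
csuc {suc k} i with view i
... | ‵fromℕ     = zero
... | ‵inject₁ j = suc j

csuc-fromℕ : ∀ k → csuc (fromℕ k) ≡ zero
csuc-fromℕ k rewrite view-fromℕ k = refl

csuc-inject₁ : ∀ {k} (j : Fin k) → csuc (inject₁ j) ≡ suc j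
csuc-inject₁ j rewrite view-inject₁ j = refl

csuc-closed : ∀ {N} {A : Set} (f : Fin (suc N) → A) → f zero ≡ f (fromℕ N) →
              ∀ i → f (suc i) ≡ f (inject₁ (csuc i))
csuc-closed {suc k} f closed i with view i
... | ‵fromℕ     = sym closed
... | ‵inject₁ j = refl

csuc-injective : ∀ {N} {i j : Fin N} → csuc i ≡ csuc j → i ≡ j
csuc-injective {suc k} {i} {j} eq with view i | view j
... | ‵fromℕ     | ‵fromℕ     = refl
... | ‵inject₁ a | ‵inject₁ b = cong inject₁ (suc-injective eq)
... | ‵fromℕ     | ‵inject₁ b with () ← eq
... | ‵inject₁ a | ‵fromℕ     with () ← eq

csuc-surjective : ∀ {N} (j : Fin N) → ∃ λ i → csuc i ≡ j
csuc-surjective {suc k} zero    = fromℕ k , csuc-fromℕ k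
csuc-surjective {suc k} (suc j) = inject₁ j , csuc-inject₁ j

csuc-≢ : ∀ {N} → 2 ≤ N → (i : Fin N) → csuc i ≢ i
csuc-≢ {suc zero} (s≤s ())
csuc-≢ {suc (suc k)} _ i = no-fixpoint (view i)
  where
  no-fixpoint : ∀ {i} → View i → csuc i ≢ i
  no-fixpoint ‵fromℕ eq = 0≢1+n (trans (sym (csuc-fromℕ (suc k))) eq)
  no-fixpoint (‵inject₁ j) eq =
    1+n≢n (trans (cong toℕ (trans (sym (csuc-inject₁ j)) eq)) (toℕ-inject₁ j))

csuc-induction : ∀ {N} (P : Fin N → Set) → (∀ i → P i → P (csuc i)) →
                 ∀ {i} → P i → ∀ j → P j
csuc-induction {suc k} P preserve {i} Pi = <-weakInduction P P-zero forward
  where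
  forward : ∀ j → P (inject₁ j) → P (suc j)
  forward j = subst P (csuc-inject₁ j) ∘ preserve (inject₁ j)

  P-zero : P zero
  P-zero = subst P (csuc-fromℕ k)
    (preserve (fromℕ k) (<-weakInduction-startingFrom P Pi forward (≤fromℕ i)))

module _ {X : Set} {g : Graph X} where

  Conn-edge : ∀ {x y} → vtx g x → vtx g y → adj g x y → Conn g x y
  Conn-edge vx vy a = step vx a (here vy)

  Conn-snoc : ∀ {x y z} → Conn g x y → vtx g z → adj g y z → Conn g x z
  Conn-snoc (here vx)      vz a = Conn-edge vx vz a
  Conn-snoc (step vx a r) vz b = step vx a (Conn-snoc r vz b)

  Conn-trans : ∀ {x y z} → Conn g x y → Conn g y z → Conn g x z
  Conn-trans (here _)      q = q
  Conn-trans (step vx a r) q = step vx a (Conn-trans r q)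

  Conn-reverse : (∀ {a b} → adj g a b → adj g b a) → ∀ {x y} → Conn g x y → Conn g y x
  Conn-reverse sym-adj (here vx)      = here vx
  Conn-reverse sym-adj (step vx a r) = Conn-snoc (Conn-reverse sym-adj r) vx (sym-adj a)

  Conn-map : {h : Graph X} → (∀ {x} → vtx g x → vtx h x) → (∀ {x y} → adj g x y → adj h x y) →
             ∀ {x y} → Conn g x y → Conn h x y
  Conn-map f-vtx f-adj (here vx)      = here (f-vtx vx)
  Conn-map f-vtx f-adj (step vx a r) = step (f-vtx vx) (f-adj a) (Conn-map f-vtx f-adj r)

module _ {H : Hypergraph} (R : Fin (n H) → Fin (m H) → Set) where

  Bip-sym : ∀ {x y} → Bip {H} R x y → Bip {H} R y x
  Bip-sym {inj₁ _} {inj₂ _} r = r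
  Bip-sym {inj₂ _} {inj₁ _} r = r

  Bip-irrefl : ∀ {x y} → Bip {H} R x y → x ≢ y
  Bip-irrefl {inj₁ _} {inj₂ _} _ ()
  Bip-irrefl {inj₂ _} {inj₁ _} _ ()

IncAdj-sym : ∀ {H x y} → IncAdj H x y → IncAdj H y x
IncAdj-sym {H} {x} {y} = Bip-sym {H} (λ v e → v ∈ edge H e) {x} {y}

vNeighbour-isE : ∀ {H v y} → IncAdj H (inj₁ v) y → ∃ λ e → y ≡ inj₂ e
vNeighbour-isE {y = inj₂ e} _ = e , refl

vNeighbour-isE′ : ∀ {H v y} → IncAdj H y (inj₁ v) → ∃ λ e → y ≡ inj₂ e
vNeighbour-isE′ {y = inj₂ e} _ = e , refl

module CycleWalk {X : Set} {g : Graph X} (C : Cycle g) where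

  pos : Fin (clen C) → X
  pos i = w C (inject₁ i)

  w-suc : ∀ i → w C (suc i) ≡ pos (csuc i)
  w-suc = csuc-closed (w C) (cclosed C)

  adj-next : ∀ i → adj g (pos i) (pos (csuc i))
  adj-next i = subst (adj g (pos i)) (w-suc i) (cadj C i)

  CEdge-next : ∀ i → CEdge C (pos i) (pos (csuc i))
  CEdge-next i = i , inj₁ (refl , w-suc i)

  onCycle-pos : ∀ {x} → OnCycle C x → ∃ λ i → pos i ≡ x
  onCycle-pos = cover (clen C) (w C) (cclosed C) (≤-trans (s≤s z≤n) (clen≥3 C))
    where
    cover : ∀ N (f : Fin (suc N) → X) → f zero ≡ f (fromℕ N) → 1 ≤ N →
            ∀ {x} → (∃ λ i → f i ≡ x) → ∃ λ j → f (inject₁ j) ≡ x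
    cover (suc _) f _      _ (zero  , fx) = zero , fx
    cover N       f closed _ (suc i , fx) = csuc i , trans (sym (csuc-closed f closed i)) fx

  CEdge-sym : ∀ {x y} → CEdge C x y → CEdge C y x
  CEdge-sym (i , c) = i , swap c

  CEdge-onCycle : ∀ {x y} → CEdge C x y → OnCycle C x × OnCycle C y
  CEdge-onCycle (i , inj₁ (wx , wy)) = (inject₁ i , wx) , (suc i , wy)
  CEdge-onCycle (i , inj₂ (wy , wx)) = (suc i , wx) , (inject₁ i , wy)

  CEdge-adj : (∀ {a b} → adj g a b → adj g b a) → ∀ {x y} → CEdge C x y → adj g x y
  CEdge-adj sym-adj (i , inj₁ (wx , wy)) = subst₂ (adj g) wx wy (cadj C i)
  CEdge-adj sym-adj (i , inj₂ (wy , wx)) = sym-adj (subst₂ (adj g) wy wx (cadj C i))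

  CEdge-neighbours : ∀ i {u} → CEdge C (pos (csuc i)) u → u ≡ pos i ⊎ u ≡ pos (csuc (csuc i))
  CEdge-neighbours i (j , inj₁ (wj , wsj)) with refl ← distinct C j (csuc i) wj =
    inj₂ (trans (sym wsj) (w-suc j))
  CEdge-neighbours i (j , inj₂ (wj , wsj))
    with refl ← csuc-injective (distinct C _ _ (trans (sym (w-suc j)) wsj)) = inj₁ (sym wj)

  CEdge? : DecidableEquality X → ∀ x y → Dec (CEdge C x y)
  CEdge? _≟_ x y = any? λ i → (w C (inject₁ i) ≟ x ×-dec w C (suc i) ≟ y)
                          ⊎-dec (w C (inject₁ i) ≟ y ×-dec w C (suc i) ≟ x)

module EulerFamilyFacts {H : Hypergraph} (F : EulerFamily H) where

  GFAdj-sym : ∀ {x y} → GFAdj F x y → GFAdj F y x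
  GFAdj-sym {x} {y} = Bip-sym {H} (ConsecIn F) {x} {y}

  GFAdj-irrefl : ∀ {x y} → GFAdj F x y → x ≢ y
  GFAdj-irrefl {x} {y} = Bip-irrefl {H} (ConsecIn F) {x} {y}

  ConsecIn? : ∀ v e → Dec (ConsecIn F v e)
  ConsecIn? v e = any? λ i → any? λ p → let T = trails F i in
    edg T p ≟ᶠ e ×-dec (anc T (inject₁ p) ≟ᶠ v ⊎-dec anc T (suc p) ≟ᶠ v)

  edge-twoAnchors : ∀ e → ∃ λ v → ∃ λ v′ → v ≢ v′ × ConsecIn F v e × ConsecIn F v′ e
  edge-twoAnchors e with covers F e
  ... | i , p , ep =
    _ , _ , step≢ (trails F i) p , (i , p , ep , inj₁ refl) , (i , p , ep , inj₂ refl)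

  consecutiveEdges-distinct : ∀ (T : ClosedTrail H) p → edg T p ≢ edg T (csuc p)
  consecutiveEdges-distinct T p eq = csuc-≢ (len≥2 T) p (sym (trail T p (csuc p) eq))

  anchor-otherEdge : ∀ {v e} → ConsecIn F v e → ∃ λ u → u ≢ e × ConsecIn F v u
  anchor-otherEdge (i , p , refl , inj₂ ev) =
    edg T (csuc p) , consecutiveEdges-distinct T p ∘ sym ,
    (i , csuc p , refl , inj₁ (trans (sym (csuc-closed (anc T) (closed T) p)) ev))
    where T = trails F i
  anchor-otherEdge (i , p , refl , inj₁ ev) with csuc-surjective p
  ... | q , refl =
    edg T q , consecutiveEdges-distinct T q ,
    (i , q , refl , inj₂ (trans (csuc-closed (anc T) (closed T) q) ev))
    where T = trails F i

module InterchangingCycle {H : Hypergraph} (F : EulerFamily H) (C : Cycle (IncGraph H))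
  (interchanging : Interchanging F C)
  (oneNontrivial : ∀ c → OnCycle C c → AtMostOneNontrivial (CompMinusC F C c)) where

  open CycleWalk C
  open EulerFamilyFacts F

  _≟ⱽ_ : DecidableEquality (IVert H)
  _≟ⱽ_ = ≡-dec _≟ᶠ_ _≟ᶠ_

  S : Graph (IVert H)
  S = SymDiffInduced F C

  S-sym : ∀ {x y} → adj S x y → adj S y x
  S-sym {x} {y} (ux , uy , inj₁ (gf , nc)) = uy , ux , inj₁ (GFAdj-sym {x} {y} gf , nc ∘ CEdge-sym)
  S-sym {x} {y} (ux , uy , inj₂ (ng , c))  = uy , ux , inj₂ (ng ∘ GFAdj-sym {y} {x} , CEdge-sym c)

  onCycle-inUnion : ∀ {x} → OnCycle C x → InUnion F C x
  onCycle-inUnion {x} ox = x , ox , here x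

  cycleEdge-conn : ∀ {x y} → ¬ GFAdj F x y → CEdge C x y → Conn S x y
  cycleEdge-conn ng c = Conn-edge ux uy (ux , uy , inj₂ (ng , c))
    where
    ux = onCycle-inUnion (proj₁ (CEdge-onCycle c))
    uy = onCycle-inUnion (proj₂ (CEdge-onCycle c))

  compMinusC-conn : ∀ {c x y} → OnCycle C c → Conn (CompMinusC F C c) x y → Conn S x y
  compMinusC-conn {c} oc = Conn-map (λ cx → c , oc , cx)
    (λ (cx , cy , gf , nc) → (c , oc , cx) , (c , oc , cy) , inj₁ (gf , nc))

  nontrivial-conn : ∀ {c x y} → OnCycle C c → NontrivialComp (CompMinusC F C c) x →
                    NontrivialComp (CompMinusC F C c) y → Conn S x y
  nontrivial-conn {c} oc ntx nty = compMinusC-conn oc (oneNontrivial c oc _ _ ntx nty)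

  offCycleEdge-nontrivial : ∀ {c x u} → InCompOf F c x → GFAdj F x u → ¬ CEdge C x u →
                            NontrivialComp (CompMinusC F C c) x
  offCycleEdge-nontrivial {x = x} {u} cx gf nc =
    cx , u , GFAdj-irrefl {x} {u} gf ∘ sym , Conn-edge cx cu (cx , cu , gf , nc)
    where cu = Conn-snoc cx u gf

  consecIn-inComp : ∀ {v e} → ConsecIn F v e → InCompOf F (inj₁ v) (inj₂ e)
  consecIn-inComp {v} {e} gf = Conn-edge (inj₁ v) (inj₂ e) gf

  interchanging-offCycleAnchor : ∀ {e} → OnCycle C (inj₂ e) →
                                 ∃ λ z → ConsecIn F z e × ¬ CEdge C (inj₂ e) (inj₁ z)
  interchanging-offCycleAnchor {e} oe with edge-twoAnchors e | interchanging e oe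
  ... | v , v′ , v≢v′ , gv , gv′ | y , _ , onlyY with inj₁ v ≟ⱽ y
  ... | yes refl = v′ , gv′ , λ c → v≢v′ (sym (inj₁-injective (onlyY _ c gv′)))
  ... | no v≢y   = v , gv , λ c → v≢y (onlyY _ c gv)

  cycleE-nontrivial : ∀ {c e} → OnCycle C (inj₂ e) → InCompOf F c (inj₂ e) →
                      NontrivialComp (CompMinusC F C c) (inj₂ e)
  cycleE-nontrivial oe ce with interchanging-offCycleAnchor oe
  ... | z , gz , nc = offCycleEdge-nontrivial ce gz nc

  Anchored : IVert H → Set
  Anchored x = ∃ λ e → OnCycle C (inj₂ e) × Conn S x (inj₂ e)

  anchored-prepend : ∀ {x y} → Conn S x y → Anchored y → Anchored x
  anchored-prepend xy (e , oe , ye) = e , oe , Conn-trans xy ye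

  pos-afterV : ∀ {i v} → pos i ≡ inj₁ v → ∃ λ e → pos (csuc i) ≡ inj₂ e
  pos-afterV {i} {v} pv =
    vNeighbour-isE {v = v} (subst (λ x → IncAdj H x (pos (csuc i))) pv (adj-next i))

  pos-beforeV : ∀ {i v} → pos (csuc i) ≡ inj₁ v → ∃ λ e → pos i ≡ inj₂ e
  pos-beforeV {i} {v} pv = vNeighbour-isE′ {v = v} (subst (IncAdj H (pos i)) pv (adj-next i))

  cycleV-eNeighbour : ∀ {v} → OnCycle C (inj₁ v) → ∃ λ e → CEdge C (inj₁ v) (inj₂ e)
  cycleV-eNeighbour ov with onCycle-pos ov
  ... | j , pj with pos-afterV pj
  ... | e , pe = e , subst₂ (CEdge C) pj pe (CEdge-next j)

  cycleV-anchored : ∀ {v} → OnCycle C (inj₁ v) →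
                    NontrivialComp (CompMinusC F C (inj₁ v)) (inj₁ v) → Anchored (inj₁ v)
  cycleV-anchored {v} ov ntv with cycleV-eNeighbour ov
  ... | e , ce with ConsecIn? v e
  ... | yes gf = e , oe , nontrivial-conn ov ntv (cycleE-nontrivial oe (consecIn-inComp gf))
    where oe = proj₂ (CEdge-onCycle ce)
  ... | no ng  = e , proj₂ (CEdge-onCycle ce) , cycleEdge-conn ng ce

  centre-hasNeighbour : ∀ {c y} → NontrivialComp (CompMinusC F C c) y → ∃ λ u → GFAdj F c u
  centre-hasNeighbour (step _ gf _ , _)                             = _ , gf
  centre-hasNeighbour (here _ , _ , z≢y , here _)                   = ⊥-elim (z≢y refl)
  centre-hasNeighbour (here _ , _ , _ , step _ (_ , _ , gf , _) _) = _ , gf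

  compMinusC-anchored : ∀ {c y} → OnCycle C c → NontrivialComp (CompMinusC F C c) y → Anchored y
  compMinusC-anchored {inj₂ e} oc nty =
    e , oc , nontrivial-conn oc nty (cycleE-nontrivial oc (here (inj₂ e)))
  compMinusC-anchored {inj₁ v} oc nty with centre-hasNeighbour nty
  ... | inj₂ e , gf with CEdge? _≟ⱽ_ (inj₁ v) (inj₂ e)
  ...   | yes ce = e , oe , nontrivial-conn oc nty (cycleE-nontrivial oe (consecIn-inComp gf))
    where oe = proj₂ (CEdge-onCycle ce)
  ...   | no nc  = anchored-prepend (nontrivial-conn oc nty ntv) (cycleV-anchored oc ntv)
    where ntv = offCycleEdge-nontrivial (here (inj₁ v)) gf nc

  cycleEdge-anchored : ∀ {x u} → ¬ GFAdj F x u → CEdge C x u → Anchored x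
  cycleEdge-anchored {inj₂ e}            _  c = e , ox , here (onCycle-inUnion ox)
    where ox = proj₁ (CEdge-onCycle c)
  cycleEdge-anchored {inj₁ _} {inj₂ e}  ng c = e , proj₂ (CEdge-onCycle c) , cycleEdge-conn ng c
  cycleEdge-anchored {inj₁ _} {inj₁ _}  _  c =
    ⊥-elim (CEdge-adj (λ {a} {b} → IncAdj-sym {H} {a} {b}) c)

  symDiff-anchored : ∀ {x} → NontrivialComp S x → Anchored x
  symDiff-anchored (_ , _ , z≢x , here _) = ⊥-elim (z≢x refl)
  symDiff-anchored ((c , oc , cx) , _ , _ , step _ (_ , _ , inj₁ (gf , nc)) _) =
    compMinusC-anchored oc (offCycleEdge-nontrivial cx gf nc)
  symDiff-anchored (_ , _ , _ , step _ (_ , _ , inj₂ (ng , c)) _) = cycleEdge-anchored ng c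

  CycleNeighboursWithin : Fin (n H) → Fin (m H) → Fin (m H) → Set
  CycleNeighboursWithin v e e′ = ∀ u → CEdge C (inj₁ v) (inj₂ u) → u ≡ e ⊎ u ≡ e′

  towardV-conn : ∀ {v e e′} → CEdge C (inj₁ v) (inj₂ e) → ConsecIn F v e → ¬ ConsecIn F v e′ →
                 CycleNeighboursWithin v e e′ → Conn S (inj₂ e) (inj₁ v)
  towardV-conn {v} ce gf ng′ within with anchor-otherEdge gf
  ... | u , u≢e , gu = nontrivial-conn ov (cycleE-nontrivial oe (consecIn-inComp gf)) ntv
    where
    ov = proj₁ (CEdge-onCycle ce)
    oe = proj₂ (CEdge-onCycle ce)
    nc : ¬ CEdge C (inj₁ v) (inj₂ u)
    nc cu = [ u≢e , (λ u≡e′ → ng′ (subst (ConsecIn F v) u≡e′ gu)) ]′ (within u cu)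
    ntv = offCycleEdge-nontrivial (here (inj₁ v)) gu nc

  throughV-conn : ∀ {v e e′} → CEdge C (inj₁ v) (inj₂ e) → CEdge C (inj₁ v) (inj₂ e′) →
                  CycleNeighboursWithin v e e′ → Conn S (inj₂ e) (inj₂ e′)
  throughV-conn {v} {e} {e′} ce ce′ within with ConsecIn? v e | ConsecIn? v e′
  ... | yes gf | yes gf′ = nontrivial-conn (proj₁ (CEdge-onCycle ce))
    (cycleE-nontrivial (proj₂ (CEdge-onCycle ce))  (consecIn-inComp gf))
    (cycleE-nontrivial (proj₂ (CEdge-onCycle ce′)) (consecIn-inComp gf′))
  ... | yes gf | no ng′  = Conn-trans (towardV-conn ce gf ng′ within) (cycleEdge-conn ng′ ce′)
  ... | no ng  | yes gf′ = Conn-trans (cycleEdge-conn ng (CEdge-sym ce))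
    (Conn-reverse S-sym (towardV-conn ce′ gf′ ng (λ u → swap ∘ within u)))
  ... | no ng  | no ng′  = Conn-trans (cycleEdge-conn ng (CEdge-sym ce)) (cycleEdge-conn ng′ ce′)

  EEndpoint : Fin (clen C) → Fin (m H) → Set
  EEndpoint i e = pos i ≡ inj₂ e ⊎ pos (csuc i) ≡ inj₂ e

  EEndpoint-unique : ∀ {i a b} → EEndpoint i a → EEndpoint i b → a ≡ b
  EEndpoint-unique     (inj₁ p) (inj₁ q) = inj₂-injective (trans (sym p) q)
  EEndpoint-unique     (inj₂ p) (inj₂ q) = inj₂-injective (trans (sym p) q)
  EEndpoint-unique {i} (inj₁ p) (inj₂ q) = ⊥-elim (subst₂ (IncAdj H) p q (adj-next i))
  EEndpoint-unique {i} (inj₂ p) (inj₁ q) = ⊥-elim (subst₂ (IncAdj H) q p (adj-next i))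

  junction-conn : ∀ {i v e e′} → pos i ≡ inj₂ e → pos (csuc i) ≡ inj₁ v →
                  pos (csuc (csuc i)) ≡ inj₂ e′ → Conn S (inj₂ e) (inj₂ e′)
  junction-conn {i} pe pv pe′ = throughV-conn ce ce′ within
    where
    ce  = CEdge-sym (subst₂ (CEdge C) pe pv (CEdge-next i))
    ce′ = subst₂ (CEdge C) pv pe′ (CEdge-next (csuc i))
    within : CycleNeighboursWithin _ _ _
    within u cu = map⊎ (λ q → inj₂-injective (trans q pe)) (λ q → inj₂-injective (trans q pe′))
      (CEdge-neighbours i (subst (λ x → CEdge C x (inj₂ u)) (sym pv) cu))

  cycleE-conn : ∀ {a b} → OnCycle C (inj₂ a) → OnCycle C (inj₂ b) → Conn S (inj₂ a) (inj₂ b)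
  cycleE-conn {a} {b} oa ob with onCycle-pos oa | onCycle-pos ob
  ... | ia , pa | ib , pb = csuc-induction Reach reach-next reach-start ib b (inj₁ pb)
    where
    Reach : Fin (clen C) → Set
    Reach i = ∀ b → EEndpoint i b → Conn S (inj₂ a) (inj₂ b)

    reach-start : Reach ia
    reach-start b eb with refl ← EEndpoint-unique (inj₁ pa) eb = here (onCycle-inUnion oa)

    reach-next : ∀ i → Reach i → Reach (csuc i)
    reach-next i reach b eb = by-middle (pos (csuc i)) refl
      where
      by-middle : ∀ x → pos (csuc i) ≡ x → Conn S (inj₂ a) (inj₂ b)
      by-middle (inj₂ e) pe with refl ← EEndpoint-unique (inj₁ pe) eb = reach e (inj₂ pe)
      by-middle (inj₁ v) pv with pos-beforeV {i} pv | pos-afterV {csuc i} pv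
      ... | e , pe | e′ , pe′ with refl ← EEndpoint-unique (inj₂ pe′) eb =
        Conn-trans (reach e (inj₁ pe)) (junction-conn pe pv pe′)

  symDiff-atMostOneNontrivial : AtMostOneNontrivial S
  symDiff-atMostOneNontrivial _ _ ntx nty with symDiff-anchored ntx | symDiff-anchored nty
  ... | a , oa , xa | b , ob , yb =
    Conn-trans xa (Conn-trans (cycleE-conn oa ob) (Conn-reverse S-sym yb))

lemma4p7 : (H : Hypergraph) → 0 < n H → (F : EulerFamily H) → (C : Cycle (IncGraph H))
    → Interchanging F C
    → (∀ c → OnCycle C c → AtMostOneNontrivial (CompMinusC F C c))
    → AtMostOneNontrivial (SymDiffInduced F C)
lemma4p7 H _ F C interchanging oneNontrivial =
  InterchangingCycle.symDiff-atMostOneNontrivial F C interchanging oneNontrivial
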